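{- Let $T$ be a tournament of order $n\geq 3$. If $V(T)$ has a partition into sets $X, Y$ such that $||X|-|Y||\leq 1$ and $(x,y)$ is an arc of $T$ for every $x\in X$ and every $y\in Y$, then $T$ has no $\overrightarrow{P_3}$-decomposition.
   Context: A tournament is an orientation of a complete graph. A $\overrightarrow{P_{3}}$-decomposition of a digraph is a partition of its arc set into directed paths of length $2$ (each path $u\to v\to w$ with $u,v,w$ distinct). -}

module Defs where

open import Data.Nat using (ℕ; _≤_; _+_)
open import Data.Fin using (Fin)
open import Data.Fin.Subset using (Subset; _∈_; _∉_; ∣_∣; ∁)
open import Data.Bool using (Bool; true; false)
open import Data.Product using (_×_; _,_; Σ)
open import Data.Sum using (_⊎_)
open import Data.List using (List; []; _∷_; concatMap)
open import Data.List.Relation.Unary.All using (All)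
open import Data.List.Relation.Unary.Unique.Propositional using (Unique)
import Data.List.Membership.Propositional as LMem
open import Relation.Binary.PropositionalEquality using (_≡_; _≢_)
open import Relation.Nullary using (¬_)

record Tournament (n : ℕ) : Set where
  field
    arc     : Fin n → Fin n → Bool
    irrefl  : ∀ u → arc u u ≡ false
    total   : ∀ u v → u ≢ v → (arc u v ≡ true) ⊎ (arc v u ≡ true)
    antisym : ∀ u v → arc u v ≡ true → arc v u ≡ false
open Tournament public

-- A directed path of length 2, u → v → w, given by its vertex triple.
P3 : ℕ → Set
P3 n = Fin n × Fin n × Fin n

IsP3In : ∀ {n} → Tournament n → P3 n → Set
IsP3In T (u , v , w) =
  (u ≢ v) × (v ≢ w) × (u ≢ w) × (arc T u v ≡ true) × (arc T v w ≡ true)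

arcsOfP3 : ∀ {n} → P3 n → List (Fin n × Fin n)
arcsOfP3 (u , v , w) = (u , v) ∷ (v , w) ∷ []

record P3Decomposition {n : ℕ} (T : Tournament n) : Set where
  field
    paths  : List (P3 n)
    valid  : All (IsP3In T) paths
    unique : Unique (concatMap arcsOfP3 paths)
    cover  : ∀ a b → arc T a b ≡ true →
             LMem._∈_ (a , b) (concatMap arcsOfP3 paths)

-- Write Y for the complement of X.  Since no arc goes from Y to X, the side of
-- the vertices along a path u → v → w can change at most once, so in a
-- P3-decomposition every path with an X–Y arc also has an arc inside X or
-- inside Y.  Hence |X||Y| ≤ C(|X|,2) + C(|Y|,2), i.e. (|X| − |Y|)² ≥ n, which
-- is impossible when ||X| − |Y|| ≤ 1 and n ≥ 3.
module Submission where

open import Defs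
open import Data.Nat using (ℕ; _≤_; _+_)
open import Data.Fin using (Fin)
open import Data.Fin.Subset using (Subset; _∈_; _∉_; ∣_∣; ∁)
open import Data.Bool using (true)
open import Relation.Binary.PropositionalEquality using (_≡_)
open import Relation.Nullary using (¬_)

open import Data.Nat using (suc; _*_; z≤n; s≤s)
open import Data.Nat.Properties
  using (≤-trans; ≤-antisym; ≤-reflexive; <-cmp; +-comm; +-mono-≤; +-monoˡ-≤; +-monoʳ-≤; <⇒≱;
         +-cancelˡ-≤; m≤m+n; module ≤-Reasoning)
open import Data.Nat.Tactic.RingSolver using (solve-∀)
open import Data.Fin using (zero; suc)
open import Data.Fin.Subset using (inside; outside)
open import Data.Fin.Properties using (suc-injective)
open import Data.Fin.Subset.Properties using (x∈∁p⇒x∉p)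
import Data.Bool as Bool
open import Data.Bool using (false; f≤t; b≤b)
open import Data.Product using (_×_; _,_; proj₁; proj₂; swap)
open import Data.Empty using (⊥-elim)
open import Data.List using (List; []; _∷_; _++_; map; length; concatMap; cartesianProduct; allFin; filter)
open import Data.List.Properties using (length-++; length-map; length-tabulate; length-removeAt′; filter-++)
open import Data.List.Relation.Unary.All as All using (All; []; _∷_)
import Data.List.Relation.Unary.All.Properties as All
open import Data.List.Relation.Unary.Any using (here; there)
open import Data.List.Relation.Unary.Unique.Propositional using (Unique; []; _∷_)
import Data.List.Relation.Unary.Unique.Propositional.Properties as Unique
open import Data.List.Relation.Binary.Disjoint.Propositional using (Disjoint)
open import Data.List.Relation.Binary.Subset.Propositional using () renaming (_⊆_ to _⊆ˡ_)
open import Data.List.Membership.Propositional using (_─_) renaming (_∈_ to _∈ˡ_; _∉_ to _∉ˡ_)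
open import Data.List.Membership.Propositional.Properties
  using (∈-map⁺; ∈-map⁻; ∈-filter⁺; ∈-filter⁻; ∈-++⁺ˡ; ∈-++⁺ʳ; ∈-++⁻; ∈-cartesianProduct⁺; ∈-cartesianProduct⁻)
open import Data.Vec.Base using ([]; _∷_; here; there; lookup)
open import Data.Vec.Properties using ([]=⇒lookup; lookup⇒[]=; lookup-map)
open import Data.Sum using (inj₁; inj₂)
open import Function using (_∘_; id)
open import Level using (0ℓ)
open import Relation.Unary using (Pred; Decidable)
open import Relation.Nullary using (¬?)
open import Relation.Binary.PropositionalEquality using (refl; sym; trans; cong; cong₂; _≢_; ≢-sym; module ≡-Reasoning)
open import Relation.Binary.Definitions using (tri<; tri≈; tri>)

module _ {A : Set} where

  ∈-─⁺ : ∀ {x y : A} {xs} (x∈xs : x ∈ˡ xs) → y ∈ˡ xs → y ≢ x → y ∈ˡ xs ─ x∈xs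
  ∈-─⁺ (here refl)  (here refl)  y≢x = ⊥-elim (y≢x refl)
  ∈-─⁺ (here refl)  (there y∈xs) _   = y∈xs
  ∈-─⁺ (there _)    (here y≡z)   _   = here y≡z
  ∈-─⁺ (there x∈xs) (there y∈xs) y≢x = there (∈-─⁺ x∈xs y∈xs y≢x)

  Unique⇒length≤ : ∀ {xs ys : List A} → Unique xs → xs ⊆ˡ ys → length xs ≤ length ys
  Unique⇒length≤ {[]}     _                  _     = z≤n
  Unique⇒length≤ {x ∷ xs} {ys} (x∉xs ∷ xs!) xs⊆ys = begin
    suc (length xs)          ≤⟨ s≤s (Unique⇒length≤ xs! xs⊆ys─x) ⟩
    suc (length (ys ─ x∈ys)) ≡⟨ sym (length-removeAt′ ys _) ⟩
    length ys                ∎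
    where
    open ≤-Reasoning
    x∈ys : x ∈ˡ ys
    x∈ys = xs⊆ys (here refl)
    xs⊆ys─x : xs ⊆ˡ ys ─ x∈ys
    xs⊆ys─x y∈xs = ∈-─⁺ x∈ys (xs⊆ys (there y∈xs)) (≢-sym (All.lookup x∉xs y∈xs))

module _ {A : Set} where

  Asymmetric : List (A × A) → Set
  Asymmetric L = ∀ {e} → e ∈ˡ L → swap e ∉ˡ L

  diagonal : List A → List (A × A)
  diagonal = map (λ x → x , x)

  -- L, its reversal and the diagonal of V are pairwise disjoint duplicate-free lists inside M.
  Asymmetric⇒length≤ : ∀ {L : List (A × A)} {V M} → Unique L → Asymmetric L → Unique V →
    L ⊆ˡ M → map swap L ⊆ˡ M → diagonal V ⊆ˡ M →
    length L + (length L + length V) ≤ length M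
  Asymmetric⇒length≤ {L} {V} {M} L! asym V! L⊆M swapL⊆M diagV⊆M = begin
    length L + (length L + length V)
      ≡⟨ cong (length L +_) (cong₂ _+_ (sym (length-map swap L)) (sym (length-map _ V))) ⟩
    length L + (length (map swap L) + length (diagonal V))
      ≡⟨ cong (length L +_) (sym (length-++ (map swap L))) ⟩
    length L + length (map swap L ++ diagonal V)
      ≡⟨ sym (length-++ L) ⟩
    length (L ++ map swap L ++ diagonal V)
      ≤⟨ Unique⇒length≤ combined! combined⊆M ⟩
    length M ∎
    where
    open ≤-Reasoning
    swap-disjoint-diagonal : Disjoint (map swap L) (diagonal V)
    swap-disjoint-diagonal (e∈swapL , e∈diagV) with ∈-map⁻ swap e∈swapL | ∈-map⁻ _ e∈diagV
    ... | _ , f∈L , refl | _ , _ , refl = asym f∈L f∈L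
    disjoint : Disjoint L (map swap L ++ diagonal V)
    disjoint (e∈L , e∈rest) with ∈-++⁻ (map swap L) e∈rest
    ... | inj₁ e∈swapL with ∈-map⁻ swap e∈swapL
    ...   | _ , f∈L , refl = asym f∈L e∈L
    disjoint (e∈L , _) | inj₂ e∈diagV with ∈-map⁻ _ e∈diagV
    ...   | _ , _ , refl = asym e∈L e∈L
    combined! : Unique (L ++ map swap L ++ diagonal V)
    combined! = Unique.++⁺ L!
      (Unique.++⁺ (Unique.map⁺ swap-injective L!) (Unique.map⁺ (cong proj₁) V!) swap-disjoint-diagonal)
      disjoint
      where
      swap-injective : ∀ {e f : A × A} → swap e ≡ swap f → e ≡ f
      swap-injective refl = refl
    combined⊆M : L ++ map swap L ++ diagonal V ⊆ˡ M
    combined⊆M e∈ with ∈-++⁻ L e∈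
    ... | inj₁ e∈L = L⊆M e∈L
    ... | inj₂ e∈rest with ∈-++⁻ (map swap L) e∈rest
    ...   | inj₁ e∈swapL = swapL⊆M e∈swapL
    ...   | inj₂ e∈diagV = diagV⊆M e∈diagV

length-cartesianProduct : ∀ {A B : Set} (xs : List A) (ys : List B) →
  length (cartesianProduct xs ys) ≡ length xs * length ys
length-cartesianProduct []       ys = refl
length-cartesianProduct (x ∷ xs) ys = trans (length-++ (map (x ,_) ys))
  (cong₂ _+_ (length-map (x ,_) ys) (length-cartesianProduct xs ys))

length-filter-++ : ∀ {A : Set} {p} {P : Pred A p} (P? : Decidable P) xs ys →
  length (filter P? (xs ++ ys)) ≡ length (filter P? xs) + length (filter P? ys)
length-filter-++ P? xs ys = trans (cong length (filter-++ P? xs ys)) (length-++ (filter P? xs))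

module _ {A B : Set} {p q} {P : Pred A p} {Q : Pred A q} (P? : Decidable P) (Q? : Decidable Q) where

  filter-concatMap-mono : ∀ (f : B → List A) {bs} →
    All (λ b → length (filter P? (f b)) ≤ length (filter Q? (f b))) bs →
    length (filter P? (concatMap f bs)) ≤ length (filter Q? (concatMap f bs))
  filter-concatMap-mono f []                 = z≤n
  filter-concatMap-mono f {b ∷ bs} (b≤ ∷ bs≤) = begin
    length (filter P? (f b ++ concatMap f bs))
      ≡⟨ length-filter-++ P? (f b) _ ⟩
    length (filter P? (f b)) + length (filter P? (concatMap f bs))
      ≤⟨ +-mono-≤ b≤ (filter-concatMap-mono f bs≤) ⟩
    length (filter Q? (f b)) + length (filter Q? (concatMap f bs))
      ≡⟨ sym (length-filter-++ Q? (f b) _) ⟩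
    length (filter Q? (f b ++ concatMap f bs)) ∎
    where open ≤-Reasoning

elements : ∀ {n} → Subset n → List (Fin n)
elements []            = []
elements (inside  ∷ p) = zero ∷ map suc (elements p)
elements (outside ∷ p) = map suc (elements p)

∈-elements⁺ : ∀ {n} {p : Subset n} {x} → x ∈ p → x ∈ˡ elements p
∈-elements⁺ {p = inside  ∷ p} here        = here refl
∈-elements⁺ {p = inside  ∷ p} (there x∈p) = there (∈-map⁺ suc (∈-elements⁺ x∈p))
∈-elements⁺ {p = outside ∷ p} (there x∈p) = ∈-map⁺ suc (∈-elements⁺ x∈p)

∈-elements⁻ : ∀ {n} {p : Subset n} {x} → x ∈ˡ elements p → x ∈ p
∈-elements⁻ {p = inside ∷ p} (here refl) = here
∈-elements⁻ {p = inside ∷ p} (there x∈) with ∈-map⁻ suc x∈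
... | _ , y∈ , refl = there (∈-elements⁻ y∈)
∈-elements⁻ {p = outside ∷ p} x∈ with ∈-map⁻ suc x∈
... | _ , y∈ , refl = there (∈-elements⁻ y∈)

elements-unique : ∀ {n} (p : Subset n) → Unique (elements p)
elements-unique []            = []
elements-unique (inside  ∷ p) =
  All.map⁺ (All.universal (λ _ ()) (elements p)) ∷ Unique.map⁺ suc-injective (elements-unique p)
elements-unique (outside ∷ p) = Unique.map⁺ suc-injective (elements-unique p)

length-elements : ∀ {n} (p : Subset n) → length (elements p) ≡ ∣ p ∣
length-elements []            = refl
length-elements (inside  ∷ p) = cong suc (trans (length-map suc (elements p)) (length-elements p))
length-elements (outside ∷ p) = trans (length-map suc (elements p)) (length-elements p)

IsArc : ∀ {n} → Tournament n → Pred (Fin n × Fin n) 0ℓ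
IsArc T (u , v) = arc T u v ≡ true

module _ {n} {T : Tournament n} (D : P3Decomposition T) where
  open P3Decomposition D

  arcs : List (Fin n × Fin n)
  arcs = concatMap arcsOfP3 paths

  arcs-valid : All (IsArc T) arcs
  arcs-valid = All.concat⁺ (All.map⁺ (All.map path-arcs valid))
    where
    path-arcs : ∀ {p} → IsP3In T p → All (IsArc T) (arcsOfP3 p)
    path-arcs (_ , _ , _ , uv , vw) = uv ∷ vw ∷ []

  arcs-asymmetric : Asymmetric arcs
  arcs-asymmetric {u , v} uv∈ vu∈
    with () ← trans (sym (All.lookup arcs-valid vu∈)) (antisym T u v (All.lookup arcs-valid uv∈))

module _ {n} (X : Subset n) where

  SameSide : Pred (Fin n × Fin n) 0ℓ
  SameSide (u , v) = lookup X u ≡ lookup X v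

  sameSide? : Decidable SameSide
  sameSide? (u , v) = lookup X u Bool.≟ lookup X v

  crossing? : Decidable (¬_ ∘ SameSide)
  crossing? = ¬? ∘ sameSide?

  lookup≡true⇒∈ : ∀ {x} → lookup X x ≡ true → x ∈ X
  lookup≡true⇒∈ = lookup⇒[]= _ X

  lookup≡false⇒∈∁ : ∀ {x} → lookup X x ≡ false → x ∈ ∁ X
  lookup≡false⇒∈∁ {x} eq = lookup⇒[]= x (∁ X) (trans (lookup-map x Bool.not X) (cong Bool.not eq))

  blocks : List (Fin n × Fin n)
  blocks = cartesianProduct (elements X) (elements X)
        ++ cartesianProduct (elements (∁ X)) (elements (∁ X))

  length-blocks : length blocks ≡ ∣ X ∣ * ∣ X ∣ + ∣ ∁ X ∣ * ∣ ∁ X ∣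
  length-blocks = begin
    length blocks
      ≡⟨ length-++ (cartesianProduct (elements X) (elements X)) ⟩
    length (cartesianProduct (elements X) (elements X)) + length (cartesianProduct (elements (∁ X)) (elements (∁ X)))
      ≡⟨ cong₂ _+_ (length-cartesianProduct (elements X) _) (length-cartesianProduct (elements (∁ X)) _) ⟩
    length (elements X) * length (elements X) + length (elements (∁ X)) * length (elements (∁ X))
      ≡⟨ cong₂ _+_ (cong₂ _*_ (length-elements X) (length-elements X))
                   (cong₂ _*_ (length-elements (∁ X)) (length-elements (∁ X))) ⟩
    ∣ X ∣ * ∣ X ∣ + ∣ ∁ X ∣ * ∣ ∁ X ∣ ∎
    where open ≡-Reasoning

  sameSide⇒∈blocks : ∀ {e} → SameSide e → e ∈ˡ blocks
  sameSide⇒∈blocks {u , v} eq with lookup X u in eu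
  ... | true  = ∈-++⁺ˡ
    (∈-cartesianProduct⁺ (∈-elements⁺ (lookup≡true⇒∈ eu)) (∈-elements⁺ (lookup≡true⇒∈ (sym eq))))
  ... | false = ∈-++⁺ʳ _
    (∈-cartesianProduct⁺ (∈-elements⁺ (lookup≡false⇒∈∁ eu)) (∈-elements⁺ (lookup≡false⇒∈∁ (sym eq))))

  module _ {T : Tournament n} (D : P3Decomposition T) where

    sameSideArcs crossingArcs : List (Fin n × Fin n)
    sameSideArcs = filter sameSide? (arcs D)
    crossingArcs = filter crossing? (arcs D)

    sameSideArcs-bound :
      length sameSideArcs + (length sameSideArcs + n) ≤ ∣ X ∣ * ∣ X ∣ + ∣ ∁ X ∣ * ∣ ∁ X ∣
    sameSideArcs-bound = begin
      length sameSideArcs + (length sameSideArcs + n)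
        ≡⟨ cong (λ m → length sameSideArcs + (length sameSideArcs + m)) (sym (length-tabulate id)) ⟩
      length sameSideArcs + (length sameSideArcs + length (allFin n))
        ≤⟨ Asymmetric⇒length≤ (Unique.filter⁺ sameSide? {arcs D} (P3Decomposition.unique D)) asymmetric
             (Unique.allFin⁺ n) (sameSide⇒∈blocks ∘ sameSide) swap⊆blocks diagonal⊆blocks ⟩
      length blocks
        ≡⟨ length-blocks ⟩
      ∣ X ∣ * ∣ X ∣ + ∣ ∁ X ∣ * ∣ ∁ X ∣ ∎
      where
      open ≤-Reasoning
      sameSide : ∀ {e} → e ∈ˡ sameSideArcs → SameSide e
      sameSide = proj₂ ∘ ∈-filter⁻ sameSide? {xs = arcs D}
      arcs-of : sameSideArcs ⊆ˡ arcs D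
      arcs-of = proj₁ ∘ ∈-filter⁻ sameSide? {xs = arcs D}
      asymmetric : Asymmetric sameSideArcs
      asymmetric e∈ swap-e∈ = arcs-asymmetric D (arcs-of e∈) (arcs-of swap-e∈)
      swap⊆blocks : map swap sameSideArcs ⊆ˡ blocks
      swap⊆blocks e∈ with ∈-map⁻ swap e∈
      ... | _ , f∈ , refl = sameSide⇒∈blocks (sym (sameSide f∈))
      diagonal⊆blocks : diagonal (allFin n) ⊆ˡ blocks
      diagonal⊆blocks e∈ with ∈-map⁻ _ e∈
      ... | _ , _ , refl = sameSide⇒∈blocks refl

module _ {n} {T : Tournament n} {X : Subset n}
         (X⇒∁X : ∀ x y → x ∈ X → y ∈ ∁ X → arc T x y ≡ true) where

  arc-side-antitone : ∀ {u v} → arc T u v ≡ true → lookup X v Bool.≤ lookup X u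
  arc-side-antitone {u} {v} uv with lookup X u in eu | lookup X v in ev
  ... | true  | true  = b≤b
  ... | true  | false = f≤t
  ... | false | false = b≤b
  ... | false | true
    with () ← trans (sym uv) (antisym T v u (X⇒∁X v u (lookup≡true⇒∈ X ev) (lookup≡false⇒∈∁ X eu)))

  path-crossings≤sameSide : ∀ {p} → IsP3In T p →
    length (filter (crossing? X) (arcsOfP3 p)) ≤ length (filter (sameSide? X) (arcsOfP3 p))
  path-crossings≤sameSide {u , v , w} (_ , _ , _ , uv , vw) = begin
    length (filter (crossing? X) ((u , v) ∷ (v , w) ∷ []))
      ≡⟨ length-filter-++ (crossing? X) ((u , v) ∷ []) _ ⟩
    count (crossing? X) (u , v) + count (crossing? X) (v , w)
      ≤⟨ side-changes-once (arc-side-antitone uv) (arc-side-antitone vw) ⟩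
    count (sameSide? X) (u , v) + count (sameSide? X) (v , w)
      ≡⟨ sym (length-filter-++ (sameSide? X) ((u , v) ∷ []) _) ⟩
    length (filter (sameSide? X) ((u , v) ∷ (v , w) ∷ [])) ∎
    where
    open ≤-Reasoning
    count : ∀ {P : Pred (Fin n × Fin n) 0ℓ} → Decidable P → Fin n × Fin n → ℕ
    count P? e = length (filter P? (e ∷ []))
    side-changes-once : lookup X v Bool.≤ lookup X u → lookup X w Bool.≤ lookup X v →
      count (crossing? X) (u , v) + count (crossing? X) (v , w) ≤
      count (sameSide? X) (u , v) + count (sameSide? X) (v , w)
    side-changes-once vu wv with lookup X u | lookup X v | lookup X w
    side-changes-once _   _   | true  | true  | true  = z≤n
    side-changes-once _   _   | true  | true  | false = s≤s z≤n
    side-changes-once _   _   | true  | false | false = s≤s z≤n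
    side-changes-once _   _   | false | false | false = z≤n
    side-changes-once _   ()  | true  | false | true
    side-changes-once ()  _   | false | true  | _
    side-changes-once _   ()  | false | false | true

  module _ (D : P3Decomposition T) where

    crossingArcs≤sameSideArcs : length (crossingArcs X D) ≤ length (sameSideArcs X D)
    crossingArcs≤sameSideArcs = filter-concatMap-mono (crossing? X) (sameSide? X) arcsOfP3
      (All.map path-crossings≤sameSide (P3Decomposition.valid D))

    ∣X∣*∣∁X∣≤crossingArcs : ∣ X ∣ * ∣ ∁ X ∣ ≤ length (crossingArcs X D)
    ∣X∣*∣∁X∣≤crossingArcs = begin
      ∣ X ∣ * ∣ ∁ X ∣
        ≡⟨ sym (cong₂ _*_ (length-elements X) (length-elements (∁ X))) ⟩
      length (elements X) * length (elements (∁ X))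
        ≡⟨ sym (length-cartesianProduct (elements X) _) ⟩
      length (cartesianProduct (elements X) (elements (∁ X)))
        ≤⟨ Unique⇒length≤ (Unique.cartesianProduct⁺ (elements-unique X) (elements-unique (∁ X))) X×∁X⊆crossing ⟩
      length (crossingArcs X D) ∎
      where
      open ≤-Reasoning
      crossing : ∀ {x y} → x ∈ X → y ∈ ∁ X → ¬ SameSide X (x , y)
      crossing x∈X y∈∁X same = x∈∁p⇒x∉p y∈∁X (lookup≡true⇒∈ X (trans (sym same) ([]=⇒lookup x∈X)))
      X×∁X⊆crossing : cartesianProduct (elements X) (elements (∁ X)) ⊆ˡ crossingArcs X D
      X×∁X⊆crossing {x , y} e∈ with ∈-cartesianProduct⁻ (elements X) _ e∈
      ... | x∈ , y∈ = ∈-filter⁺ (crossing? X)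
        (P3Decomposition.cover D x y (X⇒∁X x y (∈-elements⁻ x∈) (∈-elements⁻ y∈)))
        (crossing (∈-elements⁻ x∈) (∈-elements⁻ y∈))

square-gap : ∀ a b → a ≤ b + 1 → b ≤ a + 1 → a * a + b * b ≤ a * b + (a * b + 1)
square-gap a b a≤b+1 b≤a+1 with <-cmp a b
... | tri≈ _ refl _ = +-monoʳ-≤ (a * a) (m≤m+n (a * a) 1)
... | tri< a<b _ _ with ≤-antisym b≤a+1 (≤-trans (≤-reflexive (+-comm a 1)) a<b)
...   | refl = ≤-reflexive (identity a)
  where
  identity : ∀ a → a * a + (a + 1) * (a + 1) ≡ a * (a + 1) + (a * (a + 1) + 1)
  identity = solve-∀
square-gap a b a≤b+1 b≤a+1 | tri> _ _ b<a with ≤-antisym a≤b+1 (≤-trans (≤-reflexive (+-comm b 1)) b<a)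
...   | refl = ≤-reflexive (identity b)
  where
  identity : ∀ b → (b + 1) * (b + 1) + b * b ≡ (b + 1) * b + ((b + 1) * b + 1)
  identity = solve-∀

balanced-no-room : ∀ {n a b i} → a ≤ b + 1 → b ≤ a + 1 → a * b ≤ i →
  i + (i + n) ≤ a * a + b * b → n ≤ 1
balanced-no-room {n} {a} {b} {i} a≤b+1 b≤a+1 ab≤i room =
  +-cancelˡ-≤ i n 1 (+-cancelˡ-≤ i (i + n) (i + 1) (begin
    i + (i + n)           ≤⟨ room ⟩
    a * a + b * b         ≤⟨ square-gap a b a≤b+1 b≤a+1 ⟩
    a * b + (a * b + 1)   ≤⟨ +-mono-≤ ab≤i (+-monoˡ-≤ 1 ab≤i) ⟩
    i + (i + 1)           ∎))
  where open ≤-Reasoning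

corollary3p4 : (n : ℕ) → 3 ≤ n → (T : Tournament n) → (X : Subset n) →
    ∣ X ∣ ≤ ∣ ∁ X ∣ + 1 → ∣ ∁ X ∣ ≤ ∣ X ∣ + 1 →
    (∀ x y → x ∈ X → y ∈ ∁ X → arc T x y ≡ true) →
    ¬ P3Decomposition T
corollary3p4 n 3≤n T X ∣X∣≤∣∁X∣+1 ∣∁X∣≤∣X∣+1 X⇒∁X D = <⇒≱ (s≤s (s≤s z≤n)) (≤-trans 3≤n n≤1)
  where
  n≤1 : n ≤ 1
  n≤1 = balanced-no-room ∣X∣≤∣∁X∣+1 ∣∁X∣≤∣X∣+1
    (≤-trans (∣X∣*∣∁X∣≤crossingArcs X⇒∁X D) (crossingArcs≤sameSideArcs X⇒∁X D))
    (sameSideArcs-bound X D)
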